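{- Let $k$ and $n$ be positive integers with $n\ge2$. Then \[\Phi_n^{(k)}(0)=\mathcal{B}_k\big(-r_1(n),\,-1!\,r_2(n),\,\dots,\,-(k-1)!\,r_k(n)\big).\]
   Context: $\Phi_n$ is the $n$-th cyclotomic polynomial. $r_j(n)=\sum_{1\le m\le n,\ \gcd(m,n)=1}\zeta_n^{mj}$ (Ramanujan sum), $\zeta_n=e^{2\pi i/n}$. The complete Bell polynomial is $\mathcal{B}_k(x_1,\dots,x_k)=\sum\frac{k!}{\lambda_1!\cdots\lambda_k!}\prod_{j=1}^k(x_j/j!)^{\lambda_j}$, summing over non-negative integer tuples $(\lambda_1,\dots,\lambda_k)$ with $\sum_j j\lambda_j=k$. -}

module Defs where

open import Level using (Level)
open import Algebra.Bundles using (CommutativeRing)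
open import Data.Nat as ℕ using (ℕ; zero; suc; _!; NonZero)
open import Data.Nat.Properties using (m*n≢0; m^n≢0; _!≢0)
open import Data.Nat.Coprimality using (coprime?)
open import Data.List using (List; []; _∷_; map; filter; upTo; foldr)
open import Relation.Binary.PropositionalEquality using (_≡_)
open import Relation.Nullary.Decidable using (Dec)

tuples : ℕ → ℕ → List (List ℕ)
tuples zero    b = [] ∷ []
tuples (suc l) b =
  foldr (λ v acc → Data.List._++_ (map (v ∷_) (tuples l b)) acc) [] (upTo (suc b))

weight : ℕ → List ℕ → ℕ
weight i []       = 0
weight i (l ∷ ls) = i ℕ.* l ℕ.+ weight (suc i) ls

denom : ℕ → List ℕ → ℕ
denom i []       = 1
denom i (l ∷ ls) = (l ! ℕ.* ((i !) ℕ.^ l)) ℕ.* denom (suc i) ls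

denom≢0 : ∀ i ls → NonZero (denom i ls)
denom≢0 i []       = _
denom≢0 i (l ∷ ls) =
  m*n≢0 _ _ {{m*n≢0 _ _ {{l !≢0}} {{m^n≢0 (i !) l {{i !≢0}}}}}} {{denom≢0 (suc i) ls}}

bellCoeff : ℕ → List ℕ → ℕ
bellCoeff k ls = ℕ._/_ (k !) (denom 1 ls) {{denom≢0 1 ls}}

bellTuples : ℕ → List (List ℕ)
bellTuples k = filter (λ ls → weight 1 ls ℕ.≟ k) (tuples k k)

coprimeRange : ℕ → List ℕ
coprimeRange n = filter (λ m → coprime? m n) (map suc (upTo n))

module _ {c ℓ : Level} (R : CommutativeRing c ℓ) where
  open CommutativeRing R

  natMul : ℕ → Carrier → Carrier
  natMul zero    x = 0#
  natMul (suc n) x = x + natMul n x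

  pow : Carrier → ℕ → Carrier
  pow x zero    = 1#
  pow x (suc n) = x * pow x n

  sumR : List Carrier → Carrier
  sumR = foldr _+_ 0#

  -- polynomials as coefficient lists, constant term first
  Poly : Set c
  Poly = List Carrier

  polyAdd : Poly → Poly → Poly
  polyAdd []       q        = q
  polyAdd (a ∷ p)  []       = a ∷ p
  polyAdd (a ∷ p)  (b ∷ q)  = (a + b) ∷ polyAdd p q

  polyScale : Carrier → Poly → Poly
  polyScale a = map (a *_)

  polyMul : Poly → Poly → Poly
  polyMul []      q = []
  polyMul (a ∷ p) q = polyAdd (polyScale a q) (0# ∷ polyMul p q)

  derivFrom : ℕ → Poly → Poly
  derivFrom i []      = []
  derivFrom i (b ∷ q) = natMul i b ∷ derivFrom (suc i) q

  deriv : Poly → Poly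
  deriv []      = []
  deriv (a ∷ p) = derivFrom 1 p

  iterDeriv : ℕ → Poly → Poly
  iterDeriv zero    p = p
  iterDeriv (suc k) p = iterDeriv k (deriv p)

  evalAt0 : Poly → Carrier
  evalAt0 []      = 0#
  evalAt0 (a ∷ p) = a

  IsPrimitiveRoot : ℕ → Carrier → Set ℓ
  IsPrimitiveRoot n ζ =
    (pow ζ n ≈ 1#) × (∀ d → 1 ℕ.≤ d → d ℕ.< n → ¬ (pow ζ d ≈ 1#))
    where open import Data.Product using (_×_)
          open import Relation.Nullary using (¬_)

  cyclotomic : ℕ → Carrier → Poly
  cyclotomic n ζ =
    foldr (λ m acc → polyMul ((- pow ζ m) ∷ 1# ∷ []) acc) (1# ∷ [])
          (coprimeRange n)

  ramanujan : ℕ → Carrier → ℕ → Carrier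
  ramanujan n ζ j = sumR (map (λ m → pow ζ (m ℕ.* j)) (coprimeRange n))

  monomial : (ℕ → Carrier) → ℕ → List ℕ → Carrier
  monomial x i []       = 1#
  monomial x i (l ∷ ls) = pow (x i) l * monomial x (suc i) ls

  bell : ℕ → (ℕ → Carrier) → Carrier
  bell k x = sumR (map (λ ls → natMul (bellCoeff k ls) (monomial x 1 ls)) (bellTuples k))

  -- characteristic zero and integral domain (properties of ℂ used as ambient)
  CharZero : Set ℓ
  CharZero = ∀ m → natMul m 1# ≈ 0# → m ≡ 0

  IsDomain : Set (c Level.⊔ ℓ)
  IsDomain = (¬ (1# ≈ 0#)) × (∀ a b → a * b ≈ 0# → (a ≈ 0#) ⊎ (b ≈ 0#))
    where open import Data.Product using (_×_)
          open import Data.Sum using (_⊎_)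
          open import Relation.Nullary using (¬_)

-- Both sides are read as Taylor data at 0, i.e. sequences u with u i = f⁽ⁱ⁾(0).  On
-- Taylor data differentiation is the shift D and multiplication is the Leibniz product
-- ⋆, and a solution of a linear equation f' = g·f is determined by f(0) (ode-unique).
-- (1) Φ_n = Π_{m ∈ (ℤ/n)^×} (t − ζᵐ) satisfies Φ_n' = (Σ_m 1/(t − ζᵐ))·Φ_n, and since
--     1/(t − ζᵐ) = −Σ_j ζ^{−m(j+1)} tʲ, the reflection m ↦ n − m of the reduced residues
--     gives the logarithmic derivative the Taylor data −j! r_{j+1}(n); also Φ_n(0) = 1.
-- (2) With x_j = −(j−1)! r_j(n), the product of exp(x_j tʲ/j!) over j ≤ k, truncated at
--     degree k, satisfies F' = (Σ_j x_j t^{j−1}/(j−1)!)·F below degree k and F(0) = 1,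
--     and expanding the product shows that its k-th entry is B_k(x_1,…,x_k).
module Submission where

open import Defs
open import Level using (Level)
open import Algebra.Bundles using (CommutativeRing)
import Data.Nat
open import Data.Nat as ℕ using (ℕ; zero; suc; _∸_; _!; _≤_; _<_; z≤n; s≤s; NonZero)
import Data.Nat.Properties as ℕₚ
open ℕₚ using (_!*_!≢0)
open import Data.Nat.Combinatorics
  using (_C_; nCk≡n!/k![n-k]!; k![n∸k]!∣n!; nCk+nC[k+1]≡[n+1]C[k+1]; k>n⇒nCk≡0; nC1≡n)
open import Data.Nat.DivMod using (_/_; m/n*n≡m; m*n/n≡m)
open import Data.Nat.Divisibility using (_∣_; _∣0; ∣-refl; ∣m∣n⇒∣m+n; ∣m+n∣m⇒∣n)
open import Data.Nat.Coprimality using (Coprime; coprime?)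
open import Data.Nat.Solver using (module +-*-Solver)
open import Data.List using (List; []; _∷_; _++_; map; filter; foldr; applyUpTo; upTo)
import Relation.Binary.PropositionalEquality as ≡
open ≡ using (_≡_; _≢_)
open import Data.Empty using (⊥-elim)
open import Data.Sum using (inj₁; inj₂)
open import Data.List.Relation.Unary.All as All using (All; []; _∷_)
import Data.List.Relation.Unary.All.Properties as All
open import Relation.Nullary using (Dec; yes; no; ¬_)
open import Data.Product using (_,_; proj₁; proj₂)

module Factorials where
  open import Data.Nat using (_+_; _*_; _^_)
  open ℕₚ using (*-comm; *-suc; m+n∸m≡n; m≤m+n)
  open ≡ using (refl; sym; cong; cong₂)
  open ≡.≡-Reasoning
  open +-*-Solver

  C-factorial : ∀ a b → ((a + b) C a) * (a ! * b !) ≡ (a + b) !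
  C-factorial a b = begin
    ((a + b) C a) * (a ! * b !)          ≡⟨ cong (λ t → ((a + b) C a) * (a ! * t !)) (sym (m+n∸m≡n a b)) ⟩
    ((a + b) C a) * d                    ≡⟨ cong (_* d) (nCk≡n!/k![n-k]! a≤a+b) ⟩
    ((a + b) ! / d) * d                ≡⟨ m/n*n≡m (k![n∸k]!∣n! a≤a+b) ⟩
    (a + b) !                          ∎
    where
      a≤a+b : a ≤ a + b
      a≤a+b = m≤m+n a b
      d : ℕ
      d = a ! * (a + b ∸ a) !
      instance
        d≢0 : NonZero d
        d≢0 = a !* (a + b ∸ a) !≢0

  -- blocks p v = (v(p+1))! / (v! ((p+1)!)^v) is the number of ways to split a set of
  -- v(p+1) elements into v unordered blocks of size p+1.  It is defined by the
  -- recursion that removes the block containing the last element.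
  blocks : ℕ → ℕ → ℕ
  blocks p zero    = 1
  blocks p (suc v) = ((p + suc p * v) C p) * blocks p v

  blocks-factorial : ∀ p v → blocks p v * (v ! * (suc p !) ^ v) ≡ (suc p * v) !
  blocks-factorial p zero = cong _! (sym (*-comm p 0))
  blocks-factorial p (suc v) = begin
    (B' * blocks p v) * (suc v ! * (suc p !) ^ suc v)
      ≡⟨ solve 7 (λ B' B V vf P pf S →
           (B' :* B) :* (((con 1 :+ V) :* vf) :* (((con 1 :+ P) :* pf) :* S))
           := (B' :* (pf :* (B :* (vf :* S)))) :* (con 1 :+ (P :+ (con 1 :+ P) :* V)))
         refl B' (blocks p v) v (v !) p (p !) ((suc p !) ^ v) ⟩
    B' * (p ! * (blocks p v * (v ! * (suc p !) ^ v))) * suc (p + A)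
      ≡⟨ cong (λ t → B' * (p ! * t) * suc (p + A)) (blocks-factorial p v) ⟩
    B' * (p ! * A !) * suc (p + A)      ≡⟨ cong (_* suc (p + A)) (C-factorial p A) ⟩
    (p + A) ! * suc (p + A)              ≡⟨ *-comm ((p + A) !) (suc (p + A)) ⟩
    suc (p + A) !                        ≡⟨ cong _! (sym (*-suc (suc p) v)) ⟩
    (suc p * suc v) !                    ∎
    where
      A : ℕ
      A = suc p * v
      B' : ℕ
      B' = (p + A) C p

  -- The multinomial coefficient attached to a tuple (λ_i, λ_{i+1}, …) with i = p+1:
  -- first choose which elements go into blocks of size i, then split them into blocks.
  multinomial : ℕ → List ℕ → ℕ
  multinomial p []       = 1
  multinomial p (v ∷ ls) = (weight (suc p) (v ∷ ls) C (suc p * v)) * blocks p v * multinomial (suc p) ls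

  -- (Σ_j j λ_j)! = Π_j λ_j! (j!)^{λ_j} · multinomial, so the Bell coefficient is an integer.
  weight-factorial : ∀ p ls → weight (suc p) ls ! ≡ denom (suc p) ls * multinomial p ls
  weight-factorial p []       = refl
  weight-factorial p (v ∷ ls) = begin
    (c + w) !                                                ≡⟨ sym (C-factorial c w) ⟩
    ((c + w) C c) * (c ! * w !)
      ≡⟨ cong₂ (λ s t → ((c + w) C c) * (s * t)) (sym (blocks-factorial p v)) (weight-factorial (suc p) ls) ⟩
    ((c + w) C c) * ((blocks p v * (v ! * (i !) ^ v)) * (denom (suc i) ls * multinomial i ls))
      ≡⟨ solve 5 (λ W B F D M → W :* ((B :* F) :* (D :* M)) := (F :* D) :* (W :* B :* M))
           refl ((c + w) C c) (blocks p v) (v ! * (i !) ^ v) (denom (suc i) ls) (multinomial i ls) ⟩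
    denom i (v ∷ ls) * multinomial p (v ∷ ls)               ∎
    where
      i : ℕ
      i = suc p
      c : ℕ
      c = i * v
      w : ℕ
      w = weight (suc i) ls

  bellCoeff-multinomial : ∀ p ls m → weight (suc p) ls ≡ m →
                          (m ! / denom (suc p) ls) {{denom≢0 (suc p) ls}} ≡ multinomial p ls
  bellCoeff-multinomial p ls m refl = begin
    (weight (suc p) ls ! / D) {{D≢0}}         ≡⟨ cong (λ t → (t / D) {{D≢0}}) (weight-factorial p ls) ⟩
    (D * multinomial p ls / D) {{D≢0}}        ≡⟨ cong (λ t → (t / D) {{D≢0}}) (*-comm D (multinomial p ls)) ⟩
    (multinomial p ls * D / D) {{D≢0}}        ≡⟨ m*n/n≡m (multinomial p ls) D {{D≢0}} ⟩
    multinomial p ls                          ∎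
    where
      D : ℕ
      D = denom (suc p) ls
      D≢0 : NonZero D
      D≢0 = denom≢0 (suc p) ls

module Coprimality where
  open ℕₚ using (m∸n+n≡m; m∸[m∸n]≡n; m∸n≤m)

  coprime-reflect : ∀ n t → t ≤ n → Coprime t n → Coprime (n ∸ t) n
  coprime-reflect n t t≤n coprime {d} (d∣n-t , d∣n) =
    coprime (∣m+n∣m⇒∣n (≡.subst (d ∣_) (≡.sym (m∸n+n≡m t≤n)) d∣n) d∣n-t , d∣n)

  coprime-unreflect : ∀ n t → t ≤ n → Coprime (n ∸ t) n → Coprime t n
  coprime-unreflect n t t≤n coprime =
    ≡.subst (λ u → Coprime u n) (m∸[m∸n]≡n t≤n) (coprime-reflect n (n ∸ t) (m∸n≤m n t) coprime)

  0-not-coprime : ∀ n → 2 ≤ n → ¬ Coprime 0 n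
  0-not-coprime n 2≤n coprime = ℕₚ.<-irrefl (≡.sym (coprime (n ∣0 , ∣-refl))) 2≤n

  coprime-midpoint : ∀ n t → t ℕ.+ t ≡ n → Coprime t n → t ≡ 1
  coprime-midpoint n t 2t≡n coprime = coprime (∣-refl , ≡.subst (t ∣_) 2t≡n (∣m∣n⇒∣m+n ∣-refl ∣-refl))

module RingFacts {c ℓ : Level} (R : CommutativeRing c ℓ) where
  open CommutativeRing R hiding (zero)
  open import Algebra.Properties.Ring ring public
    using (-‿distribˡ-*; -‿distribʳ-*; -‿involutive; -‿+-comm; -0#≈0#; +-inverseʳ-unique)
  open import Algebra.Properties.Semiring.Mult semiring public
    using (_×_; ×-cong; ×-congʳ; ×-congˡ; ×-homo-+; ×-homo-1; ×-assocˡ; ×-comm-*; ×-assoc-*)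
  open import Algebra.Properties.CommutativeMonoid.Mult +-commutativeMonoid public
    using (×-distrib-+)
  open import Algebra.Properties.Semiring.Exp semiring public
    using (_^_; ^-homo-*; ^-assocʳ)
  open import Algebra.Properties.CommutativeSemigroup +-commutativeSemigroup public
    using () renaming (interchange to +-interchange)
  open import Relation.Binary.Reasoning.Setoid setoid

  natMul≡× : ∀ n x → natMul R n x ≡ n × x
  natMul≡× zero    x = ≡.refl
  natMul≡× (suc n) x = ≡.cong (x +_) (natMul≡× n x)

  pow≡^ : ∀ x n → pow R x n ≡ x ^ n
  pow≡^ x zero    = ≡.refl
  pow≡^ x (suc n) = ≡.cong (x *_) (pow≡^ x n)

  ×-zeroʳ : ∀ n → n × 0# ≈ 0#
  ×-zeroʳ zero    = refl
  ×-zeroʳ (suc n) = trans (+-identityˡ _) (×-zeroʳ n)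

  ×-neg : ∀ n x → n × (- x) ≈ - (n × x)
  ×-neg zero    x = sym -0#≈0#
  ×-neg (suc n) x = trans (+-congˡ (×-neg n x)) (-‿+-comm x (n × x))

  pow-+ : ∀ x a b → pow R x (a ℕ.+ b) ≈ pow R x a * pow R x b
  pow-+ x a b = begin
    pow R x (a ℕ.+ b)      ≡⟨ pow≡^ x (a ℕ.+ b) ⟩
    x ^ (a ℕ.+ b)          ≈⟨ ^-homo-* x a b ⟩
    x ^ a * x ^ b          ≡⟨ ≡.cong₂ _*_ (≡.sym (pow≡^ x a)) (≡.sym (pow≡^ x b)) ⟩
    pow R x a * pow R x b  ∎

  pow-* : ∀ x a b → pow R (pow R x a) b ≈ pow R x (a ℕ.* b)
  pow-* x a b = begin
    pow R (pow R x a) b    ≡⟨ ≡.trans (pow≡^ _ b) (≡.cong (_^ b) (pow≡^ x a)) ⟩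
    (x ^ a) ^ b            ≈⟨ ^-assocʳ x a b ⟩
    x ^ (a ℕ.* b)          ≡⟨ ≡.sym (pow≡^ x (a ℕ.* b)) ⟩
    pow R x (a ℕ.* b)      ∎

  neg*neg : ∀ u v → (- u) * (- v) ≈ u * v
  neg*neg u v = trans (sym (-‿distribˡ-* u (- v))) (trans (-‿cong (sym (-‿distribʳ-* u v))) (-‿involutive _))

  square-root-of-1 : IsDomain R → ∀ z → z * z ≈ 1# → ¬ (z ≈ 1#) → - z ≈ 1#
  square-root-of-1 (_ , no-zero-divisors) z z²≈1 z≉1 with no-zero-divisors (z + 1#) (z + - 1#) product≈0
    where
      product≈0 : (z + 1#) * (z + - 1#) ≈ 0#
      product≈0 = begin
        (z + 1#) * (z + - 1#)             ≈⟨ distribʳ (z + - 1#) z 1# ⟩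
        z * (z + - 1#) + 1# * (z + - 1#)  ≈⟨ +-cong (distribˡ z z (- 1#)) (*-identityˡ _) ⟩
        (z * z + z * - 1#) + (z + - 1#)   ≈⟨ +-congˡ (+-comm z (- 1#)) ⟩
        (z * z + z * - 1#) + (- 1# + z)   ≈⟨ +-interchange _ _ _ _ ⟩
        (z * z + - 1#) + (z * - 1# + z)   ≈⟨ +-cong (+-congʳ z²≈1) (+-congʳ (trans (sym (-‿distribʳ-* z 1#)) (-‿cong (*-identityʳ z)))) ⟩
        (1# + - 1#) + (- z + z)           ≈⟨ +-cong (-‿inverseʳ 1#) (-‿inverseˡ z) ⟩
        0# + 0#                           ≈⟨ +-identityʳ 0# ⟩
        0#                                ∎
  ... | inj₁ z+1≈0  = sym (+-inverseʳ-unique z 1# z+1≈0)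
  ... | inj₂ z-1≈0  = ⊥-elim (z≉1 (begin
        z                  ≈⟨ sym (+-identityʳ z) ⟩
        z + 0#             ≈⟨ +-congˡ (sym (-‿inverseˡ 1#)) ⟩
        z + (- 1# + 1#)    ≈⟨ sym (+-assoc _ _ _) ⟩
        (z + - 1#) + 1#    ≈⟨ +-congʳ z-1≈0 ⟩
        0# + 1#            ≈⟨ +-identityˡ 1# ⟩
        1#                 ∎))

module FiniteSums {c ℓ : Level} (R : CommutativeRing c ℓ) where
  open CommutativeRing R hiding (zero)
  open RingFacts R
  open import Relation.Binary.Reasoning.Setoid setoid

  Seq : Set c
  Seq = ℕ → Carrier

  sumN : ℕ → Seq → Carrier
  sumN zero    f = 0#
  sumN (suc N) f = f 0 + sumN N (λ i → f (suc i))

  sumN-cong : ∀ N {f g : Seq} → (∀ i → i < N → f i ≈ g i) → sumN N f ≈ sumN N g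
  sumN-cong zero    f≈g = refl
  sumN-cong (suc N) f≈g = +-cong (f≈g 0 (s≤s z≤n)) (sumN-cong N (λ i i<N → f≈g (suc i) (s≤s i<N)))

  sumN-zero : ∀ N → sumN N (λ _ → 0#) ≈ 0#
  sumN-zero zero    = refl
  sumN-zero (suc N) = trans (+-identityˡ _) (sumN-zero N)

  sumN-last : ∀ N (f : Seq) → sumN (suc N) f ≈ sumN N f + f N
  sumN-last zero    f = trans (+-identityʳ _) (sym (+-identityˡ _))
  sumN-last (suc N) f = trans (+-congˡ (sumN-last N _)) (sym (+-assoc _ _ _))

  sumN-reverse : ∀ N (f : Seq) → sumN N f ≈ sumN N (λ i → f (N ∸ suc i))
  sumN-reverse zero    f = refl
  sumN-reverse (suc N) f = begin
    sumN (suc N) f                          ≈⟨ sumN-last N f ⟩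
    sumN N f + f N                          ≈⟨ +-congʳ (sumN-reverse N f) ⟩
    sumN N (λ i → f (N ∸ suc i)) + f N      ≈⟨ +-comm _ _ ⟩
    sumN (suc N) (λ i → f (suc N ∸ suc i))  ∎

  prodN : ℕ → Seq → Carrier
  prodN zero    f = 1#
  prodN (suc N) f = f 0 * prodN N (λ i → f (suc i))

  prodN-last : ∀ N (f : Seq) → prodN (suc N) f ≈ prodN N f * f N
  prodN-last zero    f = trans (*-identityʳ _) (sym (*-identityˡ _))
  prodN-last (suc N) f = trans (*-congˡ (prodN-last N _)) (sym (*-assoc _ _ _))

  prodN-pairs : ∀ N (f : Seq) → (∀ t → t < N → f t * f (N ∸ suc t) ≈ 1#) →
                (∀ t → t < N → t ℕ.+ t ≡ N ∸ 1 → f t ≈ 1#) → prodN N f ≈ 1#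
  prodN-pairs zero             f pairs middle = refl
  prodN-pairs (suc zero)       f pairs middle = trans (*-identityʳ _) (middle 0 (s≤s z≤n) ≡.refl)
  prodN-pairs (suc (suc N)) f pairs middle = begin
    f 0 * prodN (suc N) (λ i → f (suc i))    ≈⟨ *-congˡ (prodN-last N _) ⟩
    f 0 * (prodN N inner * f (suc N))        ≈⟨ sym (*-assoc _ _ _) ⟩
    (f 0 * prodN N inner) * f (suc N)        ≈⟨ *-congʳ (*-comm _ _) ⟩
    (prodN N inner * f 0) * f (suc N)        ≈⟨ *-assoc _ _ _ ⟩
    prodN N inner * (f 0 * f (suc N))        ≈⟨ *-cong (prodN-pairs N inner inner-pairs inner-middle) (pairs 0 (s≤s z≤n)) ⟩
    1# * 1#                                  ≈⟨ *-identityʳ 1# ⟩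
    1#                                       ∎
    where
      inner : Seq
      inner i = f (suc i)
      inner-pairs : ∀ t → t < N → inner t * inner (N ∸ suc t) ≈ 1#
      inner-pairs t t<N = trans (*-congˡ (reflexive (≡.cong f (≡.sym (ℕₚ.+-∸-assoc 1 t<N)))))
                                (pairs (suc t) (s≤s (ℕₚ.m<n⇒m<1+n t<N)))
      inner-middle : ∀ t → t < N → t ℕ.+ t ≡ N ∸ 1 → inner t ≈ 1#
      inner-middle t (s≤s t≤N-1) 2t≡N-1 = middle (suc t) (s≤s (ℕₚ.m<n⇒m<1+n (s≤s t≤N-1)))
        (≡.trans (≡.cong suc (ℕₚ.+-suc t t)) (≡.cong (λ u → suc (suc u)) 2t≡N-1))

  sumList : ∀ {a} {X : Set a} → (X → Carrier) → List X → Carrier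
  sumList f []       = 0#
  sumList f (y ∷ ys) = f y + sumList f ys

  sumR≡sumList : ∀ {a} {X : Set a} (f : X → Carrier) xs → sumR R (map f xs) ≡ sumList f xs
  sumR≡sumList f []       = ≡.refl
  sumR≡sumList f (y ∷ ys) = ≡.cong (f y +_) (sumR≡sumList f ys)

  sumList-cong : ∀ {a} {X : Set a} {f g : X → Carrier} xs → (∀ y → f y ≈ g y) → sumList f xs ≈ sumList g xs
  sumList-cong []       f≈g = refl
  sumList-cong (y ∷ ys) f≈g = +-cong (f≈g y) (sumList-cong ys f≈g)

  sumList-++ : ∀ {a} {X : Set a} (f : X → Carrier) xs ys → sumList f (xs ++ ys) ≈ sumList f xs + sumList f ys
  sumList-++ f []       ys = sym (+-identityˡ _)
  sumList-++ f (y ∷ xs) ys = trans (+-congˡ (sumList-++ f xs ys)) (sym (+-assoc _ _ _))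

  sumList-map : ∀ {a b} {X : Set a} {Y : Set b} (f : Y → Carrier) (g : X → Y) xs →
                sumList f (map g xs) ≈ sumList (λ y → f (g y)) xs
  sumList-map f g []       = refl
  sumList-map f g (y ∷ ys) = +-congˡ (sumList-map f g ys)

  sumList-applyUpTo : ∀ (f : ℕ → Carrier) (g : ℕ → ℕ) N → sumList f (applyUpTo g N) ≈ sumN N (λ i → f (g i))
  sumList-applyUpTo f g zero    = refl
  sumList-applyUpTo f g (suc N) = +-congˡ (sumList-applyUpTo f (λ i → g (suc i)) N)

  *-distribˡ-sumList : ∀ {a} {X : Set a} z (f : X → Carrier) xs → z * sumList f xs ≈ sumList (λ y → z * f y) xs
  *-distribˡ-sumList z f []       = zeroʳ z
  *-distribˡ-sumList z f (y ∷ ys) = trans (distribˡ z _ _) (+-congˡ (*-distribˡ-sumList z f ys))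

  ×-distrib-sumList : ∀ {a} {X : Set a} n (f : X → Carrier) xs → n × sumList f xs ≈ sumList (λ y → n × f y) xs
  ×-distrib-sumList n f []       = ×-zeroʳ n
  ×-distrib-sumList n f (y ∷ ys) = trans (×-distrib-+ _ _ n) (+-congˡ (×-distrib-sumList n f ys))

  -‿distrib-sumList : ∀ {a} {X : Set a} (f : X → Carrier) xs → - sumList f xs ≈ sumList (λ y → - f y) xs
  -‿distrib-sumList f []       = -0#≈0#
  -‿distrib-sumList f (y ∷ ys) = trans (sym (-‿+-comm _ _)) (+-congˡ (-‿distrib-sumList f ys))

  prodList : ∀ {a} {X : Set a} → (X → Carrier) → List X → Carrier
  prodList f []       = 1#
  prodList f (y ∷ ys) = f y * prodList f ys

  prodList-map : ∀ {a b} {X : Set a} {Y : Set b} (f : Y → Carrier) (g : X → Y) xs →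
                 prodList f (map g xs) ≈ prodList (λ y → f (g y)) xs
  prodList-map f g []       = refl
  prodList-map f g (y ∷ ys) = *-congˡ (prodList-map f g ys)

  prodList-applyUpTo : ∀ (f : ℕ → Carrier) (g : ℕ → ℕ) N → prodList f (applyUpTo g N) ≈ prodN N (λ i → f (g i))
  prodList-applyUpTo f g zero    = refl
  prodList-applyUpTo f g (suc N) = *-congˡ (prodList-applyUpTo f (λ i → g (suc i)) N)

  choose : ∀ {a} {P : Set a} → Dec P → Carrier → Carrier → Carrier
  choose (yes _) y z = y
  choose (no _)  y z = z

  choose-cong : ∀ {a} {P : Set a} (d : Dec P) {y y' z} → y ≈ y' → choose d y z ≈ choose d y' z
  choose-cong (yes _) y≈y' = y≈y'
  choose-cong (no _)  _    = refl

  choose-no : ∀ {a} {P : Set a} (d : Dec P) {y z} → ¬ P → choose d y z ≈ z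
  choose-no (yes p) ¬p = ⊥-elim (¬p p)
  choose-no (no _)  ¬p = refl

  sumList-filter : ∀ {a p} {X : Set a} {P : X → Set p} (P? : ∀ y → Dec (P y)) (f : X → Carrier) xs →
                   sumList f (filter P? xs) ≈ sumList (λ y → choose (P? y) (f y) 0#) xs
  sumList-filter P? f []       = refl
  sumList-filter P? f (y ∷ ys) with P? y
  ... | yes _ = +-congˡ (sumList-filter P? f ys)
  ... | no _  = trans (sumList-filter P? f ys) (sym (+-identityˡ _))

  prodList-filter : ∀ {a p} {X : Set a} {P : X → Set p} (P? : ∀ y → Dec (P y)) (f : X → Carrier) xs →
                    prodList f (filter P? xs) ≈ prodList (λ y → choose (P? y) (f y) 1#) xs
  prodList-filter P? f []       = refl
  prodList-filter P? f (y ∷ ys) with P? y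
  ... | yes _ = *-congˡ (prodList-filter P? f ys)
  ... | no _  = trans (prodList-filter P? f ys) (sym (*-identityˡ _))

-- A sequence u is read as the Taylor data u i = f⁽ⁱ⁾(0) of a function f at 0.  On such
-- data, differentiation is the shift D and multiplication is the Leibniz product ⋆,
-- defined by the product rule.
module TaylorData {c ℓ : Level} (R : CommutativeRing c ℓ) where
  open CommutativeRing R hiding (zero)
  open RingFacts R
  open FiniteSums R
  open import Relation.Binary.Reasoning.Setoid setoid

  infix  4 _≋_
  infixl 6 _⊕_
  infixl 7 _⋆_

  _≋_ : Seq → Seq → Set ℓ
  u ≋ v = ∀ i → u i ≈ v i

  𝟘 : Seq
  𝟘 _ = 0#

  _⊕_ : Seq → Seq → Seq
  (u ⊕ v) i = u i + v i

  D : Seq → Seq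
  D u i = u (suc i)

  -- Taylor data of f·g:  (fg)(0) = f(0)g(0) and (fg)' = f'g + fg'.
  _⋆_ : Seq → Seq → Seq
  (u ⋆ v) zero    = u 0 * v 0
  (u ⋆ v) (suc m) = (D u ⋆ v) m + (u ⋆ D v) m

  ⋆-cong-≤ : ∀ m {u u' v v' : Seq} → (∀ i → i ≤ m → u i ≈ u' i) → (∀ i → i ≤ m → v i ≈ v' i) →
             (u ⋆ v) m ≈ (u' ⋆ v') m
  ⋆-cong-≤ zero    u≈ v≈ = *-cong (u≈ 0 z≤n) (v≈ 0 z≤n)
  ⋆-cong-≤ (suc m) u≈ v≈ = +-cong
    (⋆-cong-≤ m (λ i i≤m → u≈ (suc i) (s≤s i≤m)) (λ i i≤m → v≈ i (ℕₚ.m≤n⇒m≤1+n i≤m)))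
    (⋆-cong-≤ m (λ i i≤m → u≈ i (ℕₚ.m≤n⇒m≤1+n i≤m)) (λ i i≤m → v≈ (suc i) (s≤s i≤m)))

  ⋆-cong : ∀ {u u' v v'} → u ≋ u' → v ≋ v' → u ⋆ v ≋ u' ⋆ v'
  ⋆-cong u≈ v≈ m = ⋆-cong-≤ m (λ i _ → u≈ i) (λ i _ → v≈ i)

  ⋆-comm : ∀ u v → u ⋆ v ≋ v ⋆ u
  ⋆-comm u v zero    = *-comm _ _
  ⋆-comm u v (suc m) = trans (+-cong (⋆-comm (D u) v m) (⋆-comm u (D v) m)) (+-comm _ _)

  ⋆-distribʳ : ∀ u u' v → (u ⊕ u') ⋆ v ≋ u ⋆ v ⊕ u' ⋆ v
  ⋆-distribʳ u u' v zero    = distribʳ _ _ _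
  ⋆-distribʳ u u' v (suc m) =
    trans (+-cong (⋆-distribʳ (D u) (D u') v m) (⋆-distribʳ u u' (D v) m)) (+-interchange _ _ _ _)

  ⋆-distribˡ : ∀ u v v' → u ⋆ (v ⊕ v') ≋ u ⋆ v ⊕ u ⋆ v'
  ⋆-distribˡ u v v' zero    = distribˡ _ _ _
  ⋆-distribˡ u v v' (suc m) =
    trans (+-cong (⋆-distribˡ (D u) v v' m) (⋆-distribˡ u (D v) (D v') m)) (+-interchange _ _ _ _)

  ⋆-zeroˡ : ∀ v → 𝟘 ⋆ v ≋ 𝟘
  ⋆-zeroˡ v zero    = zeroˡ _
  ⋆-zeroˡ v (suc m) = trans (+-cong (⋆-zeroˡ v m) (⋆-zeroˡ (D v) m)) (+-identityʳ 0#)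

  ⋆-assoc : ∀ u v w → (u ⋆ v) ⋆ w ≋ u ⋆ (v ⋆ w)
  ⋆-assoc u v w zero    = *-assoc _ _ _
  ⋆-assoc u v w (suc m) = begin
    ((D u ⋆ v ⊕ u ⋆ D v) ⋆ w) m + ((u ⋆ v) ⋆ D w) m
      ≈⟨ +-congʳ (⋆-distribʳ (D u ⋆ v) (u ⋆ D v) w m) ⟩
    ((D u ⋆ v) ⋆ w) m + ((u ⋆ D v) ⋆ w) m + ((u ⋆ v) ⋆ D w) m
      ≈⟨ +-cong (+-cong (⋆-assoc (D u) v w m) (⋆-assoc u (D v) w m)) (⋆-assoc u v (D w) m) ⟩
    (D u ⋆ (v ⋆ w)) m + (u ⋆ (D v ⋆ w)) m + (u ⋆ (v ⋆ D w)) m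
      ≈⟨ +-assoc _ _ _ ⟩
    (D u ⋆ (v ⋆ w)) m + ((u ⋆ (D v ⋆ w)) m + (u ⋆ (v ⋆ D w)) m)
      ≈⟨ +-congˡ (sym (⋆-distribˡ u (D v ⋆ w) (v ⋆ D w) m)) ⟩
    (u ⋆ (v ⋆ w)) (suc m) ∎

  ⋆-left-comm : ∀ u v w → u ⋆ (v ⋆ w) ≋ v ⋆ (u ⋆ w)
  ⋆-left-comm u v w m = begin
    (u ⋆ (v ⋆ w)) m   ≈⟨ sym (⋆-assoc u v w m) ⟩
    ((u ⋆ v) ⋆ w) m   ≈⟨ ⋆-cong (⋆-comm u v) (λ _ → refl) m ⟩
    ((v ⋆ u) ⋆ w) m   ≈⟨ ⋆-assoc v u w m ⟩
    (v ⋆ (u ⋆ w)) m   ∎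

  ⋆-sumˡ : ∀ N (f : ℕ → Seq) v m → ((λ j → sumN N (λ w → f w j)) ⋆ v) m ≈ sumN N (λ w → (f w ⋆ v) m)
  ⋆-sumˡ zero    f v m = ⋆-zeroˡ v m
  ⋆-sumˡ (suc N) f v m =
    trans (⋆-distribʳ (f 0) _ v m) (+-congˡ (⋆-sumˡ N (λ w → f (suc w)) v m))

  ⋆-sumʳ : ∀ N u (f : ℕ → Seq) m → (u ⋆ (λ j → sumN N (λ w → f w j))) m ≈ sumN N (λ w → (u ⋆ f w) m)
  ⋆-sumʳ N u f m = trans (⋆-comm u _ m)
    (trans (⋆-sumˡ N f u m) (sumN-cong N (λ w _ → ⋆-comm (f w) u m)))

  -- δ c y is the Taylor data of the monomial y·tᶜ/c!.
  δ : ℕ → Carrier → Seq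
  δ zero    y zero    = y
  δ zero    y (suc j) = 0#
  δ (suc c) y zero    = 0#
  δ (suc c) y (suc j) = δ c y j

  δ-hit : ∀ c y j → j ≡ c → δ c y j ≈ y
  δ-hit zero    y zero    _   = refl
  δ-hit (suc c) y (suc j) j≡c = δ-hit c y j (ℕₚ.suc-injective j≡c)

  δ-miss : ∀ c y j → j ≢ c → δ c y j ≈ 0#
  δ-miss zero    y zero    j≢c = ⊥-elim (j≢c ≡.refl)
  δ-miss zero    y (suc j) _   = refl
  δ-miss (suc c) y zero    _   = refl
  δ-miss (suc c) y (suc j) j≢c = δ-miss c y j (λ j≡c → j≢c (≡.cong suc j≡c))

  δ-congʳ : ∀ c {y z} → y ≈ z → δ c y ≋ δ c z
  δ-congʳ zero    y≈z zero    = y≈z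
  δ-congʳ zero    y≈z (suc j) = refl
  δ-congʳ (suc c) y≈z zero    = refl
  δ-congʳ (suc c) y≈z (suc j) = δ-congʳ c y≈z j

  ⋆-δ : ∀ m c y u → (δ c y ⋆ u) m ≈ (m C c) × (y * u (m ∸ c))
  ⋆-δ zero    zero    y u = sym (×-homo-1 _)
  ⋆-δ zero    (suc c) y u = zeroˡ _
  ⋆-δ (suc m) zero    y u = trans (+-cong (⋆-zeroˡ u m) (⋆-δ m zero y (D u))) (+-identityˡ _)
  ⋆-δ (suc m) (suc c) y u = begin
    (δ c y ⋆ u) m + (δ (suc c) y ⋆ D u) m
      ≈⟨ +-cong (⋆-δ m c y u) (⋆-δ m (suc c) y (D u)) ⟩
    (m C c) × (y * u (m ∸ c)) + (m C suc c) × (y * u (suc (m ∸ suc c)))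
      ≈⟨ +-congˡ shift ⟩
    (m C c) × (y * u (m ∸ c)) + (m C suc c) × (y * u (m ∸ c))
      ≈⟨ sym (×-homo-+ _ (m C c) (m C suc c)) ⟩
    ((m C c) ℕ.+ (m C suc c)) × (y * u (m ∸ c))
      ≈⟨ ×-congˡ (nCk+nC[k+1]≡[n+1]C[k+1] m c) ⟩
    (suc m C suc c) × (y * u (suc m ∸ suc c)) ∎
    where
      -- for c < m the index m ∸ c is 1 + (m ∸ (c+1)); otherwise the coefficient vanishes
      shift : (m C suc c) × (y * u (suc (m ∸ suc c))) ≈ (m C suc c) × (y * u (m ∸ c))
      shift with c ℕ.<? m
      ... | yes c<m = ×-congʳ (m C suc c) (*-congˡ (reflexive (≡.cong u (≡.sym (ℕₚ.+-∸-assoc 1 c<m)))))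
      ... | no c≮m  = trans (×-congˡ (k>n⇒nCk≡0 m<c+1)) (sym (×-congˡ (k>n⇒nCk≡0 m<c+1)))
        where
          m<c+1 : m < suc c
          m<c+1 = s≤s (ℕₚ.≮⇒≥ c≮m)

  ⋆-identityˡ : ∀ u → δ 0 1# ⋆ u ≋ u
  ⋆-identityˡ u m = trans (⋆-δ m 0 1# u) (trans (×-homo-1 _) (*-identityˡ (u m)))

  δ⋆δ : ∀ p c y z → δ p y ⋆ δ c z ≋ δ (p ℕ.+ c) (((p ℕ.+ c) C p) × (y * z))
  δ⋆δ p c y z a with a ℕ.≟ p ℕ.+ c
  ... | yes ≡.refl = begin
    (δ p y ⋆ δ c z) (p ℕ.+ c)                  ≈⟨ ⋆-δ (p ℕ.+ c) p y (δ c z) ⟩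
    ((p ℕ.+ c) C p) × (y * δ c z (p ℕ.+ c ∸ p)) ≈⟨ ×-congʳ ((p ℕ.+ c) C p) (*-congˡ {y} (δ-hit c z _ (ℕₚ.m+n∸m≡n p c))) ⟩
    ((p ℕ.+ c) C p) × (y * z)                  ≈⟨ sym (δ-hit (p ℕ.+ c) _ _ ≡.refl) ⟩
    δ (p ℕ.+ c) (((p ℕ.+ c) C p) × (y * z)) (p ℕ.+ c) ∎
  ... | no a≢p+c = trans (⋆-δ a p y (δ c z)) (trans vanish (sym (δ-miss _ _ a a≢p+c)))
    where
      vanish : (a C p) × (y * δ c z (a ∸ p)) ≈ 0#
      vanish with p ℕ.≤? a
      ... | yes p≤a = trans (×-congʳ (a C p) (trans (*-congˡ (δ-miss c z (a ∸ p) a-p≢c)) (zeroʳ y)))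
                            (×-zeroʳ (a C p))
        where
          a-p≢c : a ∸ p ≢ c
          a-p≢c a-p≡c = a≢p+c (≡.trans (≡.sym (ℕₚ.m+[n∸m]≡n p≤a)) (≡.cong (p ℕ.+_) a-p≡c))
      ... | no p≰a  = ×-congˡ (k>n⇒nCk≡0 (ℕₚ.≰⇒> p≰a))

  ode-unique : ∀ k {g h u v : Seq} → u 0 ≈ v 0 → (∀ i → i < k → g i ≈ h i) →
               (∀ m → m < k → u (suc m) ≈ (g ⋆ u) m) → (∀ m → m < k → v (suc m) ≈ (h ⋆ v) m) →
               ∀ i → i ≤ k → u i ≈ v i
  ode-unique zero    u0≈v0 _   _  _  zero z≤n = u0≈v0
  ode-unique (suc k) {g} {h} {u} {v} u0≈v0 g≈h u' v' = extend
    where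
      below : ∀ i → i ≤ k → u i ≈ v i
      below = ode-unique k u0≈v0 (λ j j<k → g≈h j (ℕₚ.m<n⇒m<1+n j<k))
                (λ m m<k → u' m (ℕₚ.m<n⇒m<1+n m<k)) (λ m m<k → v' m (ℕₚ.m<n⇒m<1+n m<k))
      extend : ∀ i → i ≤ suc k → u i ≈ v i
      extend i i≤k+1 with ℕₚ.m≤n⇒m<n∨m≡n i≤k+1
      ... | inj₁ (s≤s i≤k) = below i i≤k
      ... | inj₂ ≡.refl    = begin
        u (suc k)   ≈⟨ u' k ℕₚ.≤-refl ⟩
        (g ⋆ u) k   ≈⟨ ⋆-cong-≤ k (λ j j≤k → g≈h j (s≤s j≤k)) below ⟩
        (h ⋆ v) k   ≈⟨ sym (v' k ℕₚ.≤-refl) ⟩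
        v (suc k)   ∎

-- E p is the Taylor data of
-- exp(x_{p+1} t^{p+1}/(p+1)!) truncated at the b-th power, F p l that of the product
-- E p ⋯ E (p+l-1), and G p l that of the derivative of the exponent
-- Σ_{j=p+1}^{p+l} x_j tʲ/j!.
module BellSeries {c ℓ : Level} (R : CommutativeRing c ℓ) (b : ℕ) (x : ℕ → CommutativeRing.Carrier R) where
  open CommutativeRing R hiding (zero)
  open RingFacts R
  open FiniteSums R
  open TaylorData R
  open Factorials
  open import Relation.Binary.Reasoning.Setoid setoid

  -- Taylor coefficient of (x_{p+1} t^{p+1}/(p+1)!)^v / v! in degree (p+1)v.
  expCoeff : ℕ → ℕ → Carrier
  expCoeff p v = blocks p v × pow R (x (suc p)) v

  -- Raising the power by one: the new block of size p+1 contains the last point.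
  expCoeff-step : ∀ p v → expCoeff p (suc v) ≈ ((p ℕ.+ suc p ℕ.* v) C p) × (x (suc p) * expCoeff p v)
  expCoeff-step p v = begin
    (B ℕ.* blocks p v) × (y * pow R y v)  ≈⟨ sym (×-assocˡ _ B (blocks p v)) ⟩
    B × (blocks p v × (y * pow R y v))    ≈⟨ ×-congʳ B (sym (×-comm-* (blocks p v) y _)) ⟩
    B × (y * expCoeff p v)                ∎
    where
      y : Carrier
      y = x (suc p)
      B : ℕ
      B = (p ℕ.+ suc p ℕ.* v) C p

  E : ℕ → Seq
  E p j = sumN (suc b) (λ v → δ (suc p ℕ.* v) (expCoeff p v) j)

  F : ℕ → ℕ → Seq
  F p zero    = δ 0 1#
  F p (suc l) = E p ⋆ F (suc p) l

  G : ℕ → ℕ → Seq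
  G p zero    = 𝟘
  G p (suc l) = δ p (x (suc p)) ⊕ G (suc p) l

  E-init : ∀ p → E p 0 ≈ 1#
  E-init p = begin
    δ (suc p ℕ.* 0) (expCoeff p 0) 0 + sumN b (λ _ → 0#)
      ≈⟨ +-cong (δ-hit (suc p ℕ.* 0) _ 0 (≡.sym (ℕₚ.*-zeroʳ p))) (sumN-zero b) ⟩
    1 × 1# + 0#                         ≈⟨ trans (+-identityʳ _) (×-homo-1 1#) ⟩
    1#                                  ∎

  F-init : ∀ l p → F p l 0 ≈ 1#
  F-init zero    p = refl
  F-init (suc l) p = trans (*-cong (E-init p) (F-init l (suc p))) (*-identityˡ 1#)

  E-deriv : ∀ p a → a < b → D (E p) a ≈ (δ p (x (suc p)) ⋆ E p) a
  E-deriv p a a<b = begin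
    δ (i ℕ.* 0) (expCoeff p 0) (suc a) + sumN b (λ v → δ (i ℕ.* suc v) (expCoeff p (suc v)) (suc a))
      ≈⟨ +-cong (δ-miss (i ℕ.* 0) _ (suc a) (λ e → ℕₚ.1+n≢0 (≡.trans e (ℕₚ.*-zeroʳ p))))
                (sumN-cong b (λ v _ → shifted v)) ⟩
    0# + sumN b f                       ≈⟨ +-identityˡ _ ⟩
    sumN b f                            ≈⟨ sym (+-identityʳ _) ⟩
    sumN b f + 0#                       ≈⟨ +-congˡ (sym (δ-miss (p ℕ.+ i ℕ.* b) _ a a≢p+ib)) ⟩
    sumN b f + f b                      ≈⟨ sym (sumN-last b f) ⟩
    sumN (suc b) f                      ≈⟨ sumN-cong (suc b) (λ v _ → sym (δ⋆δ p (i ℕ.* v) y (expCoeff p v) a)) ⟩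
    sumN (suc b) (λ v → (δ p y ⋆ δ (i ℕ.* v) (expCoeff p v)) a)
      ≈⟨ sym (⋆-sumʳ (suc b) (δ p y) (λ v → δ (i ℕ.* v) (expCoeff p v)) a) ⟩
    (δ p y ⋆ E p) a                     ∎
    where
      i : ℕ
      i = suc p
      y : Carrier
      y = x i
      f : Seq
      f v = δ (p ℕ.+ i ℕ.* v) (((p ℕ.+ i ℕ.* v) C p) × (y * expCoeff p v)) a
      -- the summand of index v+1 of E' is the summand of index v of the product
      shifted : ∀ v → δ (i ℕ.* suc v) (expCoeff p (suc v)) (suc a) ≈ f v
      shifted v = trans (reflexive (≡.cong (λ t → δ t (expCoeff p (suc v)) (suc a)) (ℕₚ.*-suc i v)))
                        (δ-congʳ (p ℕ.+ i ℕ.* v) (expCoeff-step p v) a)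
      -- the top summand of the product has degree beyond b
      a≢p+ib : a ≢ p ℕ.+ i ℕ.* b
      a≢p+ib e = ℕₚ.<⇒≢ (ℕₚ.<-≤-trans a<b (ℕₚ.≤-trans (ℕₚ.m≤n*m b i) (ℕₚ.m≤n+m (i ℕ.* b) p))) e

  -- F' = G·F below order b, by the product rule and E' = (x tᵖ/p!)·E.
  F-deriv : ∀ l p m → m < b → D (F p l) m ≈ (G p l ⋆ F p l) m
  F-deriv zero    p m _   = sym (⋆-zeroˡ (δ 0 1#) m)
  F-deriv (suc l) p m m<b = begin
    (D (E p) ⋆ F') m + (E p ⋆ D F') m
      ≈⟨ +-cong (⋆-cong-≤ m (λ a a≤m → E-deriv p a (ℕₚ.≤-<-trans a≤m m<b)) (λ _ _ → refl))
                (⋆-cong-≤ m (λ _ _ → refl) (λ a a≤m → F-deriv l (suc p) a (ℕₚ.≤-<-trans a≤m m<b))) ⟩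
    ((g ⋆ E p) ⋆ F') m + (E p ⋆ (G' ⋆ F')) m
      ≈⟨ +-cong (⋆-assoc g (E p) F' m) (⋆-left-comm (E p) G' F' m) ⟩
    (g ⋆ (E p ⋆ F')) m + (G' ⋆ (E p ⋆ F')) m
      ≈⟨ sym (⋆-distribʳ g G' (E p ⋆ F') m) ⟩
    ((g ⊕ G') ⋆ (E p ⋆ F')) m ∎
    where
      g : Seq
      g = δ p (x (suc p))
      F' : Seq
      F' = F (suc p) l
      G' : Seq
      G' = G (suc p) l

  G-below : ∀ l p j → j < p → G p l j ≈ 0#
  G-below zero    p j _   = refl
  G-below (suc l) p j j<p = trans (+-cong (δ-miss p _ j (ℕₚ.<⇒≢ j<p)) (G-below l (suc p) j (ℕₚ.m<n⇒m<1+n j<p)))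
                                  (+-identityʳ 0#)

  G-value : ∀ l p j → p ≤ j → j < p ℕ.+ l → G p l j ≈ x (suc j)
  G-value zero    p j p≤j j<p+0 = ⊥-elim (ℕₚ.<-irrefl ≡.refl (ℕₚ.<-≤-trans j<p+0 (ℕₚ.≤-trans (ℕₚ.≤-reflexive (ℕₚ.+-identityʳ p)) p≤j)))
  G-value (suc l) p j p≤j j<p+l+1 with j ℕ.≟ p
  ... | yes ≡.refl = trans (+-cong (δ-hit p _ j ≡.refl) (G-below l (suc p) j (ℕₚ.n<1+n j))) (+-identityʳ _)
  ... | no j≢p     = trans (+-cong (δ-miss p _ j j≢p) (G-value l (suc p) j p<j j<p+1+l)) (+-identityˡ _)
    where
      p<j : p < j
      p<j = ℕₚ.≤∧≢⇒< p≤j (λ p≡j → j≢p (≡.sym p≡j))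
      j<p+1+l : j < suc p ℕ.+ l
      j<p+1+l = ℕₚ.≤-trans j<p+l+1 (ℕₚ.≤-reflexive (ℕₚ.+-suc p l))

-- Expanding the product F 0 k into a sum over tuples (λ_1,…,λ_k) recovers the
-- defining formula of the complete Bell polynomial.
module BellExpansion {c ℓ : Level} (R : CommutativeRing c ℓ) (b : ℕ) (x : ℕ → CommutativeRing.Carrier R) where
  open CommutativeRing R hiding (zero)
  open RingFacts R
  open FiniteSums R
  open TaylorData R
  open Factorials
  open BellSeries R b x
  open import Relation.Binary.Reasoning.Setoid setoid

  bellTerm : ℕ → ℕ → List ℕ → Carrier
  bellTerm p m ls = choose (weight (suc p) ls ℕ.≟ m)
                          ((m ! / denom (suc p) ls) {{denom≢0 (suc p) ls}} × monomial R x (suc p) ls) 0#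

  -- Splitting off the first entry v of a tuple: choose which (p+1)v of the m points
  -- carry the blocks of size p+1, and split them into blocks.
  bellTerm-cons : ∀ p m v ls →
    bellTerm p m (v ∷ ls) ≈ (m C (suc p ℕ.* v)) × (expCoeff p v * bellTerm (suc p) (m ∸ suc p ℕ.* v) ls)
  bellTerm-cons p m v ls with weight (suc p) (v ∷ ls) ℕ.≟ m | weight (suc (suc p)) ls ℕ.≟ m ∸ suc p ℕ.* v
  ... | yes w≡m | yes w'≡m-iv = begin
    (m ! / denom i (v ∷ ls)) {{denom≢0 i (v ∷ ls)}} × (pow R y v * M)
      ≈⟨ ×-congˡ (bellCoeff-multinomial p (v ∷ ls) m w≡m) ⟩
    multinomial p (v ∷ ls) × (pow R y v * M)
      ≈⟨ ×-congˡ (≡.cong (λ t → (t C iv) ℕ.* blocks p v ℕ.* N) w≡m) ⟩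
    ((m C iv) ℕ.* blocks p v ℕ.* N) × (pow R y v * M)
      ≈⟨ trans (sym (×-assocˡ _ ((m C iv) ℕ.* blocks p v) N)) (sym (×-assocˡ _ (m C iv) (blocks p v))) ⟩
    (m C iv) × (blocks p v × (N × (pow R y v * M)))
      ≈⟨ ×-congʳ (m C iv) (trans (×-congʳ (blocks p v) (sym (×-comm-* N (pow R y v) M)))
                                (sym (×-assoc-* (blocks p v) (pow R y v) (N × M)))) ⟩
    (m C iv) × (expCoeff p v * (N × M))
      ≈⟨ ×-congʳ (m C iv) (*-congˡ (×-congˡ (≡.sym (bellCoeff-multinomial (suc p) ls (m ∸ iv) w'≡m-iv)))) ⟩
    (m C iv) × (expCoeff p v * ((m ∸ iv) ! / denom (suc i) ls) {{denom≢0 (suc i) ls}} × M) ∎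
    where
      i : ℕ
      i = suc p
      iv : ℕ
      iv = i ℕ.* v
      y : Carrier
      y = x i
      M : Carrier
      M = monomial R x (suc i) ls
      N : ℕ
      N = multinomial (suc p) ls
  ... | yes w≡m | no w'≢m-iv =
    ⊥-elim (w'≢m-iv (≡.sym (≡.trans (≡.cong (_∸ suc p ℕ.* v) (≡.sym w≡m)) (ℕₚ.m+n∸m≡n (suc p ℕ.* v) _))))
  ... | no _ | no _ = sym (trans (×-congʳ (m C (suc p ℕ.* v)) (zeroʳ (expCoeff p v))) (×-zeroʳ (m C (suc p ℕ.* v))))
  ... | no w≢m | yes w'≡m-iv with suc p ℕ.* v ℕ.≤? m
  ...   | yes iv≤m = ⊥-elim (w≢m (≡.trans (≡.cong (suc p ℕ.* v ℕ.+_) w'≡m-iv) (ℕₚ.m+[n∸m]≡n iv≤m)))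
  ...   | no iv≰m  = sym (×-congˡ (k>n⇒nCk≡0 (ℕₚ.≰⇒> iv≰m)))

  sumList-tuples : ∀ (h : List ℕ → Carrier) l →
    sumList h (tuples (suc l) b) ≈ sumN (suc b) (λ v → sumList (λ ls → h (v ∷ ls)) (tuples l b))
  sumList-tuples h l = trans (byFirstEntry (upTo (suc b))) (sumList-applyUpTo _ (λ v → v) (suc b))
    where
      byFirstEntry : ∀ vs → sumList h (foldr (λ v acc → map (v ∷_) (tuples l b) ++ acc) [] vs)
                            ≈ sumList (λ v → sumList (λ ls → h (v ∷ ls)) (tuples l b)) vs
      byFirstEntry []       = refl
      byFirstEntry (v ∷ vs) = trans (sumList-++ h (map (v ∷_) (tuples l b)) _)
                                    (+-cong (sumList-map h (v ∷_) (tuples l b)) (byFirstEntry vs))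

  bellSum≈F : ∀ l p m → sumList (bellTerm p m) (tuples l b) ≈ F p l m
  bellSum≈F zero    p zero    = trans (+-identityʳ _) (+-identityʳ _)
  bellSum≈F zero    p (suc m) = +-identityʳ _
  bellSum≈F (suc l) p m = begin
    sumList (bellTerm p m) (tuples (suc l) b)
      ≈⟨ sumList-tuples (bellTerm p m) l ⟩
    sumN (suc b) (λ v → sumList (λ ls → bellTerm p m (v ∷ ls)) (tuples l b))
      ≈⟨ sumN-cong (suc b) (λ v _ → firstEntry v) ⟩
    sumN (suc b) (λ v → (m C (i ℕ.* v)) × (expCoeff p v * F (suc p) l (m ∸ i ℕ.* v)))
      ≈⟨ sumN-cong (suc b) (λ v _ → sym (⋆-δ m (i ℕ.* v) (expCoeff p v) (F (suc p) l))) ⟩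
    sumN (suc b) (λ v → (δ (i ℕ.* v) (expCoeff p v) ⋆ F (suc p) l) m)
      ≈⟨ sym (⋆-sumˡ (suc b) (λ v → δ (i ℕ.* v) (expCoeff p v)) (F (suc p) l) m) ⟩
    F p (suc l) m ∎
    where
      i : ℕ
      i = suc p
      firstEntry : ∀ v → sumList (λ ls → bellTerm p m (v ∷ ls)) (tuples l b)
                         ≈ (m C (i ℕ.* v)) × (expCoeff p v * F (suc p) l (m ∸ i ℕ.* v))
      firstEntry v = begin
        sumList (λ ls → bellTerm p m (v ∷ ls)) (tuples l b)
          ≈⟨ sumList-cong (tuples l b) (bellTerm-cons p m v) ⟩
        sumList (λ ls → (m C (i ℕ.* v)) × (expCoeff p v * bellTerm i (m ∸ i ℕ.* v) ls)) (tuples l b)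
          ≈⟨ sym (×-distrib-sumList (m C (i ℕ.* v)) _ (tuples l b)) ⟩
        (m C (i ℕ.* v)) × sumList (λ ls → expCoeff p v * bellTerm i (m ∸ i ℕ.* v) ls) (tuples l b)
          ≈⟨ ×-congʳ (m C (i ℕ.* v)) (sym (*-distribˡ-sumList (expCoeff p v) _ (tuples l b))) ⟩
        (m C (i ℕ.* v)) × (expCoeff p v * sumList (bellTerm i (m ∸ i ℕ.* v)) (tuples l b))
          ≈⟨ ×-congʳ (m C (i ℕ.* v)) (*-congˡ (bellSum≈F l i (m ∸ i ℕ.* v))) ⟩
        (m C (i ℕ.* v)) × (expCoeff p v * F (suc p) l (m ∸ i ℕ.* v)) ∎

  -- B_b(x_1,…,x_b) is the b-th Taylor entry of E 0 ⋯ E (b-1), the exponential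
  -- exp(Σ_j x_j tʲ/j!) truncated beyond degree b.
  bell≈F : bell R b x ≈ F 0 b b
  bell≈F = begin
    sumR R (map term (bellTuples b))                              ≡⟨ sumR≡sumList term (bellTuples b) ⟩
    sumList term (filter (λ ls → weight 1 ls ℕ.≟ b) (tuples b b)) ≈⟨ sumList-filter _ term (tuples b b) ⟩
    sumList (λ ls → choose (weight 1 ls ℕ.≟ b) (term ls) 0#) (tuples b b)
      ≈⟨ sumList-cong (tuples b b) (λ ls → choose-cong (weight 1 ls ℕ.≟ b) (reflexive (natMul≡× (bellCoeff b ls) _))) ⟩
    sumList (bellTerm 0 b) (tuples b b)                           ≈⟨ bellSum≈F b 0 b ⟩
    F 0 b b                                                       ∎
    where
      term : List ℕ → Carrier
      term ls = natMul R (bellCoeff b ls) (monomial R x 1 ls)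

-- Taylor data of polynomials: for p = Σ aᵢ tⁱ the i-th derivative at 0 is i! aᵢ.
module PolynomialTaylor {c ℓ : Level} (R : CommutativeRing c ℓ) where
  open CommutativeRing R hiding (zero)
  open RingFacts R
  open FiniteSums R
  open TaylorData R
  open import Relation.Binary.Reasoning.Setoid setoid

  coeff : Poly R → ℕ → Carrier
  coeff []      i       = 0#
  coeff (a ∷ p) zero    = a
  coeff (a ∷ p) (suc i) = coeff p i

  coeff-polyAdd : ∀ p q i → coeff (polyAdd R p q) i ≈ coeff p i + coeff q i
  coeff-polyAdd []      q       i       = sym (+-identityˡ _)
  coeff-polyAdd (a ∷ p) []      i       = sym (+-identityʳ _)
  coeff-polyAdd (a ∷ p) (b ∷ q) zero    = refl
  coeff-polyAdd (a ∷ p) (b ∷ q) (suc i) = coeff-polyAdd p q i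

  coeff-polyScale : ∀ a p i → coeff (polyScale R a p) i ≈ a * coeff p i
  coeff-polyScale a []      i       = sym (zeroʳ a)
  coeff-polyScale a (b ∷ p) zero    = refl
  coeff-polyScale a (b ∷ p) (suc i) = coeff-polyScale a p i

  coeff-linear-zero : ∀ a p → coeff (polyMul R (a ∷ 1# ∷ []) p) 0 ≈ a * coeff p 0
  coeff-linear-zero a p =
    trans (coeff-polyAdd (polyScale R a p) _ 0) (trans (+-identityʳ _) (coeff-polyScale a p 0))

  coeff-linear-suc : ∀ a p i → coeff (polyMul R (a ∷ 1# ∷ []) p) (suc i) ≈ coeff p i + a * coeff p (suc i)
  coeff-linear-suc a p i = begin
    coeff (polyMul R (a ∷ 1# ∷ []) p) (suc i)
      ≈⟨ coeff-polyAdd (polyScale R a p) _ (suc i) ⟩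
    coeff (polyScale R a p) (suc i) + coeff (polyAdd R (polyScale R 1# p) (0# ∷ [])) i
      ≈⟨ +-cong (coeff-polyScale a p (suc i)) (coeff-polyAdd (polyScale R 1# p) (0# ∷ []) i) ⟩
    a * coeff p (suc i) + (coeff (polyScale R 1# p) i + coeff (0# ∷ []) i)
      ≈⟨ +-congˡ (+-cong (trans (coeff-polyScale 1# p i) (*-identityˡ _)) (coeff-zero i)) ⟩
    a * coeff p (suc i) + (coeff p i + 0#)
      ≈⟨ trans (+-congˡ (+-identityʳ _)) (+-comm _ _) ⟩
    coeff p i + a * coeff p (suc i) ∎
    where
      coeff-zero : ∀ j → coeff (0# ∷ []) j ≈ 0#
      coeff-zero zero    = refl
      coeff-zero (suc j) = refl

  taylor : Poly R → Seq
  taylor p i = (i !) × coeff p i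

  taylor-deriv : ∀ p → taylor (deriv R p) ≋ D (taylor p)
  taylor-deriv []      i = trans (×-zeroʳ (i !)) (sym (×-zeroʳ (suc i !)))
  taylor-deriv (a ∷ p) i = begin
    (i !) × coeff (derivFrom R 1 p) i   ≈⟨ ×-congʳ (i !) (coeff-derivFrom 1 p i) ⟩
    (i !) × (suc i × coeff p i)         ≈⟨ ×-assocˡ _ (i !) (suc i) ⟩
    (i ! ℕ.* suc i) × coeff p i       ≈⟨ ×-congˡ (ℕₚ.*-comm (i !) (suc i)) ⟩
    (suc i !) × coeff (a ∷ p) (suc i)   ∎
    where
      coeff-derivFrom : ∀ j q i → coeff (derivFrom R j q) i ≈ (j ℕ.+ i) × coeff q i
      coeff-derivFrom j []      i       = sym (×-zeroʳ (j ℕ.+ i))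
      coeff-derivFrom j (b ∷ q) zero    = trans (reflexive (natMul≡× j b)) (×-congˡ (≡.sym (ℕₚ.+-identityʳ j)))
      coeff-derivFrom j (b ∷ q) (suc i) = trans (coeff-derivFrom (suc j) q i) (×-congˡ (≡.sym (ℕₚ.+-suc j i)))

  taylor-iterDeriv : ∀ k p i → taylor (iterDeriv R k p) i ≈ taylor p (i ℕ.+ k)
  taylor-iterDeriv zero    p i = ×-cong (≡.cong _! (≡.sym (ℕₚ.+-identityʳ i))) (reflexive (≡.cong (coeff p) (≡.sym (ℕₚ.+-identityʳ i))))
  taylor-iterDeriv (suc k) p i = begin
    taylor (iterDeriv R k (deriv R p)) i  ≈⟨ taylor-iterDeriv k (deriv R p) i ⟩
    taylor (deriv R p) (i ℕ.+ k)          ≈⟨ taylor-deriv p (i ℕ.+ k) ⟩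
    taylor p (suc (i ℕ.+ k))              ≡⟨ ≡.cong (taylor p) (≡.sym (ℕₚ.+-suc i k)) ⟩
    taylor p (i ℕ.+ suc k)                ∎

  evalAt0-iterDeriv : ∀ k p → evalAt0 R (iterDeriv R k p) ≈ taylor p k
  evalAt0-iterDeriv k p = trans (evalAt0≈coeff (iterDeriv R k p)) (trans (sym (×-homo-1 _)) (taylor-iterDeriv k p 0))
    where
      evalAt0≈coeff : ∀ q → evalAt0 R q ≈ coeff q 0
      evalAt0≈coeff []      = refl
      evalAt0≈coeff (a ∷ q) = refl

  linear : Carrier → Seq
  linear a zero          = a
  linear a (suc zero)    = 1#
  linear a (suc (suc _)) = 0#

  linear≋δ : ∀ a → linear a ≋ δ 0 a ⊕ δ 1 1#
  linear≋δ a zero          = sym (+-identityʳ a)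
  linear≋δ a (suc zero)    = sym (+-identityˡ 1#)
  linear≋δ a (suc (suc i)) = sym (+-identityʳ 0#)

  D-linear : ∀ a → D (linear a) ≋ δ 0 1#
  D-linear a zero    = refl
  D-linear a (suc i) = refl

  linear⋆ : ∀ a u i → (linear a ⋆ u) i ≈ (i C 0) × (a * u i) + (i C 1) × (1# * u (i ∸ 1))
  linear⋆ a u i = begin
    (linear a ⋆ u) i                      ≈⟨ ⋆-cong (linear≋δ a) (λ _ → refl) i ⟩
    ((δ 0 a ⊕ δ 1 1#) ⋆ u) i              ≈⟨ ⋆-distribʳ (δ 0 a) (δ 1 1#) u i ⟩
    (δ 0 a ⋆ u) i + (δ 1 1# ⋆ u) i        ≈⟨ +-cong (⋆-δ i 0 a u) (⋆-δ i 1 1# u) ⟩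
    (i C 0) × (a * u i) + (i C 1) × (1# * u (i ∸ 1)) ∎

  taylor-linear : ∀ a p → taylor (polyMul R (a ∷ 1# ∷ []) p) ≋ linear a ⋆ taylor p
  taylor-linear a p zero = begin
    1 × coeff (polyMul R (a ∷ 1# ∷ []) p) 0   ≈⟨ ×-congʳ 1 (coeff-linear-zero a p) ⟩
    1 × (a * coeff p 0)                        ≈⟨ ×-congʳ 1 (*-congˡ (sym (×-homo-1 (coeff p 0)))) ⟩
    1 × (a * taylor p 0)                       ≈⟨ sym (+-identityʳ _) ⟩
    1 × (a * taylor p 0) + 0#                  ≈⟨ sym (linear⋆ a (taylor p) 0) ⟩
    (linear a ⋆ taylor p) 0                    ∎
  taylor-linear a p (suc i) = begin
    (suc i !) × coeff (polyMul R (a ∷ 1# ∷ []) p) (suc i)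
      ≈⟨ ×-congʳ (suc i !) (coeff-linear-suc a p i) ⟩
    (suc i !) × (coeff p i + a * coeff p (suc i))
      ≈⟨ ×-distrib-+ _ _ (suc i !) ⟩
    (suc i !) × coeff p i + (suc i !) × (a * coeff p (suc i))
      ≈⟨ +-cong (sym (×-assocˡ _ (suc i) (i !))) (sym (×-comm-* (suc i !) a _)) ⟩
    suc i × taylor p i + a * taylor p (suc i)
      ≈⟨ +-comm _ _ ⟩
    a * taylor p (suc i) + suc i × taylor p i
      ≈⟨ +-cong (sym (×-homo-1 _)) (×-cong (≡.sym (nC1≡n (suc i))) (sym (*-identityˡ _))) ⟩
    (suc i C 0) × (a * taylor p (suc i)) + (suc i C 1) × (1# * taylor p i)
      ≈⟨ sym (linear⋆ a (taylor p) (suc i)) ⟩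
    (linear a ⋆ taylor p) (suc i) ∎

-- Their
-- Taylor data solve the differential equation f' = g_L·f, where g_L is the Taylor data
-- of the logarithmic derivative Σ_m 1/(t − r_m) = −Σ_m Σ_j s_m^{j+1} tʲ.
module RootProduct {c ℓ : Level} (R : CommutativeRing c ℓ) (r s : ℕ → CommutativeRing.Carrier R) where
  open CommutativeRing R hiding (zero)
  open RingFacts R
  open FiniteSums R
  open TaylorData R
  open PolynomialTaylor R
  open import Relation.Binary.Reasoning.Setoid setoid

  rootProduct : List ℕ → Poly R
  rootProduct L = foldr (λ m acc → polyMul R ((- r m) ∷ 1# ∷ []) acc) (1# ∷ []) L

  -- Taylor data of 1/(t − z⁻¹) = −z/(1 − z t).
  inverseLinear : Carrier → Seq
  inverseLinear z j = - ((j !) × pow R z (suc j))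

  -- Taylor data of Σ_{m∈L} 1/(t − r_m).
  logDeriv : List ℕ → Seq
  logDeriv []      = 𝟘
  logDeriv (m ∷ L) = inverseLinear (s m) ⊕ logDeriv L

  inverseLinear⋆linear : ∀ a z → a * z ≈ 1# → inverseLinear z ⋆ linear (- a) ≋ δ 0 1#
  inverseLinear⋆linear a z az≈1 i = trans (⋆-comm (inverseLinear z) (linear (- a)) i)
                                          (trans (linear⋆ (- a) (inverseLinear z) i) (cancel i))
    where
      absorb : ∀ j → a * pow R z (suc (suc j)) ≈ pow R z (suc j)
      absorb j = trans (sym (*-assoc a z _)) (trans (*-congʳ az≈1) (*-identityˡ _))
      cancel : ∀ i → (i C 0) × (- a * inverseLinear z i) + (i C 1) × (1# * inverseLinear z (i ∸ 1)) ≈ δ 0 1# i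
      cancel zero = begin
        1 × (- a * - (1 × pow R z 1)) + 0#   ≈⟨ trans (+-identityʳ _) (×-homo-1 _) ⟩
        - a * - (1 × pow R z 1)              ≈⟨ neg*neg a _ ⟩
        a * (1 × pow R z 1)                  ≈⟨ *-congˡ (trans (×-homo-1 _) (*-identityʳ z)) ⟩
        a * z                                ≈⟨ az≈1 ⟩
        1#                                   ∎
      cancel (suc j) = begin
        1 × (- a * - X) + (suc j C 1) × (1# * - ((j !) × Z))
          ≈⟨ +-cong (trans (×-homo-1 _) (neg*neg a X)) (×-cong (nC1≡n (suc j)) (*-identityˡ _)) ⟩
        a * ((suc j !) × pow R z (suc (suc j))) + suc j × - ((j !) × Z)
          ≈⟨ +-cong (trans (×-comm-* (suc j !) a _) (×-congʳ (suc j !) (absorb j)))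
                    (trans (×-neg (suc j) _) (-‿cong (×-assocˡ Z (suc j) (j !)))) ⟩
        (suc j !) × Z + - ((suc j !) × Z)    ≈⟨ -‿inverseʳ _ ⟩
        0#                                   ∎
        where
          Z : Carrier
          Z = pow R z (suc j)
          X : Carrier
          X = (suc j !) × pow R z (suc (suc j))

  rootProduct-ode : ∀ L → All (λ m → r m * s m ≈ 1#) L → D (taylor (rootProduct L)) ≋ logDeriv L ⋆ taylor (rootProduct L)
  rootProduct-ode []      []        i = trans (×-zeroʳ (suc i !)) (sym (⋆-zeroˡ _ i))
  rootProduct-ode (m ∷ L) (rs ∷ rss) i = begin
    taylor (polyMul R (- r m ∷ 1# ∷ []) P) (suc i)
      ≈⟨ taylor-linear (- r m) P (suc i) ⟩
    (D lin ⋆ T) i + (lin ⋆ D T) i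
      ≈⟨ +-cong (trans (⋆-cong (D-linear (- r m)) (λ _ → refl) i) (⋆-identityˡ T i))
                (⋆-cong (λ _ → refl) (rootProduct-ode L rss) i) ⟩
    T i + (lin ⋆ (g ⋆ T)) i
      ≈⟨ +-cong (sym (trans (⋆-cong (inverseLinear⋆linear (r m) (s m) rs) (λ _ → refl) i) (⋆-identityˡ T i)))
                (⋆-left-comm lin g T i) ⟩
    ((h ⋆ lin) ⋆ T) i + (g ⋆ (lin ⋆ T)) i
      ≈⟨ +-congʳ (⋆-assoc h lin T i) ⟩
    (h ⋆ (lin ⋆ T)) i + (g ⋆ (lin ⋆ T)) i
      ≈⟨ sym (⋆-distribʳ h g (lin ⋆ T) i) ⟩
    ((h ⊕ g) ⋆ (lin ⋆ T)) i
      ≈⟨ ⋆-cong (λ _ → refl) (λ j → sym (taylor-linear (- r m) P j)) i ⟩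
    (logDeriv (m ∷ L) ⋆ taylor (rootProduct (m ∷ L))) i ∎
    where
      P : Poly R
      P = rootProduct L
      T : Seq
      T = taylor P
      lin : Seq
      lin = linear (- r m)
      h : Seq
      h = inverseLinear (s m)
      g : Seq
      g = logDeriv L

  rootProduct-constant : ∀ L → coeff (rootProduct L) 0 ≈ prodList (λ m → - r m) L
  rootProduct-constant []      = refl
  rootProduct-constant (m ∷ L) = trans (coeff-linear-zero (- r m) (rootProduct L)) (*-congˡ (rootProduct-constant L))

-- The cyclotomic polynomial Φ_n = Π_{m ∈ (ℤ/n)^×} (t − ζᵐ) for a primitive n-th root of
-- unity ζ in an integral domain, n ≥ 2.  The inverse of the root ζᵐ is ζ^{n−m}, and
-- the reflection m ↦ n − m of the reduced residues gives Φ_n(0) = 1 and identifies the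
-- logarithmic derivative with the Ramanujan sums.
module Cyclotomic {c ℓ : Level} (R : CommutativeRing c ℓ) (domain : IsDomain R) (n : ℕ) (2≤n : 2 ≤ n)
                  (ζ : CommutativeRing.Carrier R) (ζ-primitive : IsPrimitiveRoot R n ζ) where
  open CommutativeRing R hiding (zero)
  open RingFacts R
  open FiniteSums R
  open PolynomialTaylor R
  open Coprimality
  open RootProduct R (pow R ζ) (λ m → pow R ζ (n ∸ m)) public
  open import Relation.Binary.Reasoning.Setoid setoid

  L : List ℕ
  L = coprimeRange n

  ζⁿ≈1 : pow R ζ n ≈ 1#
  ζⁿ≈1 = proj₁ ζ-primitive

  ζ-inverse : ∀ m → m ≤ n → pow R ζ m * pow R ζ (n ∸ m) ≈ 1#
  ζ-inverse m m≤n = trans (sym (pow-+ ζ m (n ∸ m))) (trans (reflexive (≡.cong (pow R ζ) (ℕₚ.m+[n∸m]≡n m≤n))) ζⁿ≈1)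

  roots-invertible : All (λ m → pow R ζ m * pow R ζ (n ∸ m) ≈ 1#) L
  roots-invertible = All.map (λ {m} → ζ-inverse m)
    (All.filter⁺ (λ m → coprime? m n) (All.map⁺ (All.applyUpTo⁺₁ (λ i → i) n (λ i<n → i<n))))

  sum-coprime : ∀ g → sumList g L ≈ sumN (suc n) (λ t → choose (coprime? t n) (g t) 0#)
  sum-coprime g = begin
    sumList g L                              ≈⟨ sumList-filter (λ m → coprime? m n) g (map suc (upTo n)) ⟩
    sumList h (map suc (upTo n))             ≈⟨ sumList-map h suc (upTo n) ⟩
    sumList (λ i → h (suc i)) (upTo n)       ≈⟨ sumList-applyUpTo (λ i → h (suc i)) (λ i → i) n ⟩
    sumN n (λ i → h (suc i))                 ≈⟨ sym (+-identityˡ _) ⟩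
    0# + sumN n (λ i → h (suc i))            ≈⟨ +-congʳ (sym (choose-no (coprime? 0 n) (0-not-coprime n 2≤n))) ⟩
    sumN (suc n) h                           ∎
    where
      h : ℕ → Carrier
      h t = choose (coprime? t n) (g t) 0#

  prod-coprime : ∀ f → prodList f L ≈ prodN (suc n) (λ t → choose (coprime? t n) (f t) 1#)
  prod-coprime f = begin
    prodList f L                             ≈⟨ prodList-filter (λ m → coprime? m n) f (map suc (upTo n)) ⟩
    prodList h (map suc (upTo n))            ≈⟨ prodList-map h suc (upTo n) ⟩
    prodList (λ i → h (suc i)) (upTo n)      ≈⟨ prodList-applyUpTo (λ i → h (suc i)) (λ i → i) n ⟩
    prodN n (λ i → h (suc i))                ≈⟨ sym (*-identityˡ _) ⟩
    1# * prodN n (λ i → h (suc i))           ≈⟨ *-congʳ (sym (choose-no (coprime? 0 n) (0-not-coprime n 2≤n))) ⟩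
    prodN (suc n) h                          ∎
    where
      h : ℕ → Carrier
      h t = choose (coprime? t n) (f t) 1#

  -- Φ_n(0) = Π_m (−ζᵐ) = 1: the factors of m and n − m multiply to 1, and the middle
  -- factor m = n/2 only occurs for n = 2, where ζ = −1.
  cyclotomic-at-0 : coeff (cyclotomic R n ζ) 0 ≈ 1#
  cyclotomic-at-0 = begin
    coeff (rootProduct L) 0                  ≈⟨ rootProduct-constant L ⟩
    prodList (λ m → - pow R ζ m) L           ≈⟨ prod-coprime (λ m → - pow R ζ m) ⟩
    prodN (suc n) f                          ≈⟨ prodN-pairs (suc n) f pairs middle ⟩
    1#                                       ∎
    where
      f : ℕ → Carrier
      f t = choose (coprime? t n) (- pow R ζ t) 1#
      pairs : ∀ t → t < suc n → f t * f (n ∸ t) ≈ 1#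
      pairs t (s≤s t≤n) with coprime? t n | coprime? (n ∸ t) n
      ... | yes _  | yes _  = trans (neg*neg _ _) (ζ-inverse t t≤n)
      ... | yes cp | no ¬cp = ⊥-elim (¬cp (coprime-reflect n t t≤n cp))
      ... | no ¬cp | yes cp = ⊥-elim (¬cp (coprime-unreflect n t t≤n cp))
      ... | no _   | no _   = *-identityʳ 1#
      middle : ∀ t → t < suc n → t ℕ.+ t ≡ n → f t ≈ 1#
      middle t _ 2t≡n with coprime? t n
      ... | no _ = refl
      ... | yes cp with coprime-midpoint n t 2t≡n cp
      ...   | ≡.refl = square-root-of-1 domain (pow R ζ 1) ζ²≈1 (proj₂ ζ-primitive 1 ℕₚ.≤-refl 2≤n)
        where
          ζ²≈1 : pow R ζ 1 * pow R ζ 1 ≈ 1#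
          ζ²≈1 = trans (sym (pow-+ ζ 1 1)) (≡.subst (λ k → pow R ζ k ≈ 1#) (≡.sym 2t≡n) ζⁿ≈1)

  -- Σ_m ζ^{(n−m)e} = Σ_m ζ^{me} = r_e(n), by the reflection m ↦ n − m.
  inverse-power-sum : ∀ e → sumList (λ m → pow R (pow R ζ (n ∸ m)) e) L ≈ ramanujan R n ζ e
  inverse-power-sum e = begin
    sumList g L                                                  ≈⟨ sum-coprime g ⟩
    sumN (suc n) (λ t → choose (coprime? t n) (g t) 0#)          ≈⟨ sumN-reverse (suc n) (λ t → choose (coprime? t n) (g t) 0#) ⟩
    sumN (suc n) (λ t → choose (coprime? (n ∸ t) n) (g (n ∸ t)) 0#) ≈⟨ sumN-cong (suc n) reflected ⟩
    sumN (suc n) (λ t → choose (coprime? t n) (ζ^ t) 0#)         ≈⟨ sym (sum-coprime ζ^) ⟩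
    sumList ζ^ L                                                 ≡⟨ ≡.sym (sumR≡sumList ζ^ L) ⟩
    ramanujan R n ζ e                                            ∎
    where
      g ζ^ : ℕ → Carrier
      g m = pow R (pow R ζ (n ∸ m)) e
      ζ^ m = pow R ζ (m ℕ.* e)
      reflected : ∀ t → t < suc n → choose (coprime? (n ∸ t) n) (g (n ∸ t)) 0# ≈ choose (coprime? t n) (ζ^ t) 0#
      reflected t (s≤s t≤n) with coprime? (n ∸ t) n | coprime? t n
      ... | yes _  | yes _  = trans (reflexive (≡.cong (λ u → pow R (pow R ζ u) e) (ℕₚ.m∸[m∸n]≡n t≤n))) (pow-* ζ t e)
      ... | yes cp | no ¬cp = ⊥-elim (¬cp (coprime-unreflect n t t≤n cp))
      ... | no ¬cp | yes cp = ⊥-elim (¬cp (coprime-reflect n t t≤n cp))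
      ... | no _   | no _   = refl

  logDeriv≈ramanujan : ∀ j → logDeriv L j ≈ - ((j !) × ramanujan R n ζ (suc j))
  logDeriv≈ramanujan j = begin
    logDeriv L j                                                    ≈⟨ asSum L ⟩
    sumList (λ m → - ((j !) × pow R (pow R ζ (n ∸ m)) (suc j))) L   ≈⟨ sym (-‿distrib-sumList _ L) ⟩
    - sumList (λ m → (j !) × pow R (pow R ζ (n ∸ m)) (suc j)) L     ≈⟨ -‿cong (sym (×-distrib-sumList (j !) _ L)) ⟩
    - ((j !) × sumList (λ m → pow R (pow R ζ (n ∸ m)) (suc j)) L)   ≈⟨ -‿cong (×-congʳ (j !) (inverse-power-sum (suc j))) ⟩
    - ((j !) × ramanujan R n ζ (suc j))                             ∎
    where
      asSum : ∀ M → logDeriv M j ≈ sumList (λ m → inverseLinear (pow R ζ (n ∸ m)) j) M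
      asSum []      = refl
      asSum (m ∷ M) = +-congˡ (asSum M)

-- Both Φ_n⁽ⁱ⁾(0) and the Bell side solve f' = g·f with f(0) = 1 up to order k, for the
-- same g.
theorem4p2 : {c ℓ : Level} (R : CommutativeRing c ℓ) → IsDomain R → CharZero R →
    (n k : ℕ) → 2 ≤ n → 1 ≤ k → (ζ : CommutativeRing.Carrier R) → IsPrimitiveRoot R n ζ →
    CommutativeRing._≈_ R
      (evalAt0 R (iterDeriv R k (cyclotomic R n ζ)))
      (bell R k (λ j → CommutativeRing.-_ R (natMul R ((j Data.Nat.∸ 1) !) (ramanujan R n ζ j))))
theorem4p2 R domain _ n k 2≤n _ ζ ζ-primitive = begin
  evalAt0 R (iterDeriv R k Φ)  ≈⟨ evalAt0-iterDeriv k Φ ⟩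
  taylor Φ k                   ≈⟨ ode-unique k initial same-log-derivative
                                    (λ m _ → rootProduct-ode L roots-invertible m)
                                    (λ m m<k → F-deriv k 0 m m<k) k ℕₚ.≤-refl ⟩
  F 0 k k                      ≈⟨ sym bell≈F ⟩
  bell R k x                   ∎
  where
    open CommutativeRing R hiding (zero)
    open RingFacts R
    open TaylorData R
    open PolynomialTaylor R
    open Cyclotomic R domain n 2≤n ζ ζ-primitive
    x : ℕ → Carrier
    x j = - natMul R ((j ∸ 1) !) (ramanujan R n ζ j)
    open BellSeries R k x
    open BellExpansion R k x
    open import Relation.Binary.Reasoning.Setoid setoid
    Φ : Poly R
    Φ = cyclotomic R n ζ
    -- both sides start at 1: Φ_n(0) = 1 and the empty product of exponentials
    initial : taylor Φ 0 ≈ F 0 k 0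
    initial = trans (×-homo-1 _) (trans cyclotomic-at-0 (sym (F-init k 0)))
    same-log-derivative : ∀ i → i < k → logDeriv L i ≈ G 0 k i
    same-log-derivative i i<k = trans (logDeriv≈ramanujan i)
      (trans (-‿cong (reflexive (≡.sym (natMul≡× (i !) _)))) (sym (G-value k 0 i z≤n i<k)))
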